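{- For every finite multiset $G$ of I/O pairs and formulas $B,Y$: if $G\vdash(B,Y)$ is derivable in $\mathbf{C}_2$, then it is derivable in $\mathbf{C}_4$.
   Context: Formulas are classical propositional formulas; $\models$ is classical entailment. An LK sequent $\Gamma\Rightarrow\Delta$ is derivable in LK iff $\bigwedge\Gamma\models\bigvee\Delta$ (empty conjunction $=\top$, empty disjunction $=\bot$). An I/O pair is an ordered pair $(A,X)$ of formulas; an I/O sequent has the form $G\vdash(B,Y)$ with $G$ a finite multiset of pairs. Rules: (IN) from $B\Rightarrow$ infer $G\vdash(B,Y)$; (OUT) from $\Rightarrow Y$ infer $G\vdash(B,Y)$; (E2) from $G\vdash(B\wedge\neg A,Y)$ and $G\vdash(B,Y\vee\neg X)$ infer $(A,X),G\vdash(B,Y)$; (E4) from $G\vdash(B\wedge\neg A,Y)$ and $G\vdash(B\wedge X,Y\vee\neg X)$ infer $(A,X),G\vdash(B,Y)$. $\mathbf{C}_2$ has rules IN, OUT, E2; $\mathbf{C}_4$ has rules IN, OUT, E4. An I/O sequent is derivable in a calculus if it is the root of a finite tree built with its rules in which every LK-sequent premise is derivable in LK. -}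

module Defs where

open import Data.Nat using (ℕ)
open import Data.Bool using (Bool; true; false; _∧_; _∨_; not)
open import Data.List using (List; []; _∷_)
open import Data.Product using (_×_)
open import Relation.Binary.PropositionalEquality using (_≡_)
open import Data.List.Relation.Binary.Permutation.Propositional using (_↭_)

data Formula : Set where
  atom : ℕ → Formula
  ⊤f ⊥f : Formula
  ¬f_ : Formula → Formula
  _∧f_ _∨f_ _→f_ : Formula → Formula → Formula

Valuation : Set
Valuation = ℕ → Bool

⟦_⟧ : Formula → Valuation → Bool
⟦ atom n ⟧ v = v n
⟦ ⊤f ⟧ v = true
⟦ ⊥f ⟧ v = false
⟦ ¬f A ⟧ v = not (⟦ A ⟧ v)
⟦ A ∧f B ⟧ v = ⟦ A ⟧ v ∧ ⟦ B ⟧ v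
⟦ A ∨f B ⟧ v = ⟦ A ⟧ v ∨ ⟦ B ⟧ v
⟦ A →f B ⟧ v = not (⟦ A ⟧ v) ∨ ⟦ B ⟧ v

_⊨_ : Formula → Formula → Set
A ⊨ B = ∀ (v : Valuation) → ⟦ A ⟧ v ≡ true → ⟦ B ⟧ v ≡ true

-- LK-derivability of single-formula sequents, via the stated characterisation
-- (Γ ⇒ Δ derivable iff ⋀Γ ⊨ ⋁Δ)
LK⇒ : Formula → Formula → Set
LK⇒ A C = A ⊨ C

LK-left : Formula → Set           -- B ⇒   (empty succedent = ⊥)
LK-left B = B ⊨ ⊥f

LK-right : Formula → Set          -- ⇒ Y   (empty antecedent = ⊤)
LK-right Y = ⊤f ⊨ Y

-- I/O pairs; finite multisets of pairs represented as lists up to permutation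
Pair : Set
Pair = Formula × Formula

open import Data.Product using (_,_)

-- Calculus C₂ : IN, OUT, E2.  The E-rule may act on any element of the multiset,
-- expressed by G ↭ (A , X) ∷ G'.
data C₂ : List Pair → Formula → Formula → Set where
  IN  : ∀ {G B Y} → LK-left B → C₂ G B Y
  OUT : ∀ {G B Y} → LK-right Y → C₂ G B Y
  E2  : ∀ {G G' A X B Y} → G ↭ ((A , X) ∷ G') →
        C₂ G' (B ∧f (¬f A)) Y → C₂ G' B (Y ∨f (¬f X)) → C₂ G B Y

data C₄ : List Pair → Formula → Formula → Set where
  IN  : ∀ {G B Y} → LK-left B → C₄ G B Y
  OUT : ∀ {G B Y} → LK-right Y → C₄ G B Y
  E4  : ∀ {G G' A X B Y} → G ↭ ((A , X) ∷ G') →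
        C₄ G' (B ∧f (¬f A)) Y → C₄ G' (B ∧f X) (Y ∨f (¬f X)) → C₄ G B Y

-- Every E2 step is simulated by an E4 step: the right premise of E4 differs from
-- that of E2 only by the stronger input B ∧ X.  Since IN and OUT are closed under
-- strengthening inputs and weakening outputs, the translation goes through once it
-- is generalised to C₂ G B Y → C₄ G B' Y' for all B' ⊨ B and Y ⊨ Y'.
module Submission where

open import Defs
open import Data.Bool using (true; false)
open import Data.List using (List)
open import Function using (_∘_)
open import Relation.Binary.PropositionalEquality using (refl)

∧-elimˡ-⊨ : ∀ {A C} → (A ∧f C) ⊨ A
∧-elimˡ-⊨ {A} v p with ⟦ A ⟧ v
∧-elimˡ-⊨ v p  | true = refl
∧-elimˡ-⊨ v () | false

∧-monoˡ-⊨ : ∀ {A A' C} → A ⊨ A' → (A ∧f C) ⊨ (A' ∧f C)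
∧-monoˡ-⊨ {A} h v p with ⟦ A ⟧ v in eq
∧-monoˡ-⊨ h v p  | true rewrite h v eq = p
∧-monoˡ-⊨ h v () | false

∨-monoˡ-⊨ : ∀ {A A' C} → A ⊨ A' → (A ∨f C) ⊨ (A' ∨f C)
∨-monoˡ-⊨ {A} h v p with ⟦ A ⟧ v in eq
∨-monoˡ-⊨ h v p | true rewrite h v eq = refl
∨-monoˡ-⊨ {A' = A'} h v p | false with ⟦ A' ⟧ v
... | true  = refl
... | false = p

C₂⇒C₄-⊨-mono : ∀ {G B Y B' Y'} → B' ⊨ B → Y ⊨ Y' → C₂ G B Y → C₄ G B' Y'
C₂⇒C₄-⊨-mono hB hY (IN ⊥B)  = IN (λ v → ⊥B v ∘ hB v)
C₂⇒C₄-⊨-mono hB hY (OUT ⊤Y) = OUT (λ v → hY v ∘ ⊤Y v)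
C₂⇒C₄-⊨-mono {B = B} {Y} {B'} {Y'} hB hY (E2 {A = A} {X} G↭ d₁ d₂) =
  E4 G↭ (C₂⇒C₄-⊨-mono (∧-monoˡ-⊨ {B'} {B} {¬f A} hB) hY d₁)
        (C₂⇒C₄-⊨-mono (λ v → hB v ∘ ∧-elimˡ-⊨ {B'} {X} v)
                      (∨-monoˡ-⊨ {Y} {Y'} {¬f X} hY) d₂)

lemma10 : (G : List Pair) (B Y : Formula) → C₂ G B Y → C₄ G B Y
lemma10 G B Y = C₂⇒C₄-⊨-mono (λ v p → p) (λ v p → p)
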